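{- Let $f:\{0,1\}^n\to\{0,1\}$ be a Boolean function with Möbius support $\mathcal{S}_f$. For any two distinct sets $S,T\in\mathcal{S}_f$ there exists a set $p(\{S,T\})\subseteq\mathcal{S}_f$ such that: (i) $p(\{S,T\})\neq\{S,T\}$; (ii) $|p(\{S,T\})|=2$ if $S\cup T\notin\mathcal{S}_f$ and $|p(\{S,T\})|=1$ if $S\cup T\in\mathcal{S}_f$; and (iii) $\bigcup_{U\in p(\{S,T\})}U=S\cup T$.
   Context: Every $f:\{0,1\}^n\to\{0,1\}$ has a unique expansion $f=\sum_{S\subseteq[n]}\widetilde f(S)\mathsf{AND}_S$ with real coefficients, where $\mathsf{AND}_S(x)=\prod_{i\in S}x_i$; its Möbius support is $\mathcal{S}_f=\{S\subseteq[n]:\widetilde f(S)\neq0\}$. -}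

module Defs where

open import Data.Nat using (ℕ; zero; suc)
open import Data.Bool using (Bool; true; false; if_then_else_)
open import Data.Integer using (ℤ; _+_; _*_; 0ℤ; 1ℤ)
open import Data.Vec using (Vec; []; _∷_)
open import Data.List using (List; []; _∷_; map; _++_; foldr)
open import Data.Fin.Subset using (Subset; inside; outside; _∪_; ⊥)
open import Relation.Binary.PropositionalEquality using (_≡_; _≢_)

toℤ : Bool → ℤ
toℤ true  = 1ℤ
toℤ false = 0ℤ

AND : ∀ {n} → Subset n → Vec Bool n → ℤ
AND []            []       = 1ℤ
AND (inside ∷ S)  (b ∷ x)  = toℤ b * AND S x
AND (outside ∷ S) (b ∷ x)  = AND S x

allSubsets : (n : ℕ) → List (Subset n)
allSubsets zero    = [] ∷ []
allSubsets (suc n) = map (outside ∷_) (allSubsets n) ++ map (inside ∷_) (allSubsets n)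

expansion : ∀ {n} → (Subset n → ℤ) → Vec Bool n → ℤ
expansion {n} c x = foldr (λ S acc → c S * AND S x + acc) 0ℤ (allSubsets n)

IsMobiusExpansion : ∀ {n} → (Vec Bool n → Bool) → (Subset n → ℤ) → Set
IsMobiusExpansion f c = ∀ x → toℤ (f x) ≡ expansion c x

InSupport : ∀ {n} → (Subset n → ℤ) → Subset n → Set
InSupport c S = c S ≢ 0ℤ

⋃ : ∀ {n} → List (Subset n) → Subset n
⋃ = foldr _∪_ ⊥

-- Since f is 0/1-valued, f * f = f. As AND_A * AND_B = AND_(A ∪ B), uniqueness of the Möbius
-- expansion turns this into c W = Σ_{A ∪ B = W} c A * c B for every W. If S ∪ T lies in the
-- support, p = {S ∪ T} works. Otherwise this sum vanishes for W = S ∪ T although the two terms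
-- (S , T) and (T , S) both equal c S * c T ≢ 0; were they the only nonzero terms, the sum would
-- be a positive multiple of c S * c T. So some other covering (A , B) of S ∪ T has c A * c B ≢ 0,
-- and p = {A , B} works (A ≢ B because c A ≢ 0 = c (S ∪ T)).
module Submission where

open import Defs
open import Data.Nat using (ℕ; zero; suc)
open import Data.Bool using (Bool; true; false; _∨_)
open import Data.Integer using (ℤ; _+_; _*_; 0ℤ)
import Data.Integer as Int
open import Data.Integer.Properties as ℤ using (_≟_)
open import Data.Integer.Tactic.RingSolver using (solve-∀)
open import Algebra.Properties.AbelianGroup ℤ.+-0-abelianGroup using (∙-cancelˡ)
open import Data.Vec using (Vec; []; _∷_)
import Data.Vec.Properties as Vec
import Data.Bool.Properties as Bool
open import Data.Product using (Σ; ∃; _×_; _,_; proj₁; proj₂; uncurry)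
import Data.Product.Properties as Product
open import Data.Sum using (_⊎_; inj₁; inj₂)
open import Data.Empty using (⊥-elim)
open import Data.List using (List; length; []; _∷_; _++_; map; foldr)
open import Data.List.Relation.Unary.All as All using (All; []; _∷_)
open import Data.List.Relation.Unary.All.Properties using (¬Any⇒All¬)
open import Data.List.Relation.Unary.Any using (Any; here; there; any?)
open import Data.List.Relation.Unary.Unique.Propositional using (Unique)
open import Data.List.Relation.Unary.AllPairs using ([]; _∷_)
open import Data.List.Membership.Propositional using (_∈_; find; lose)
open import Data.List.Membership.Propositional.Properties
  using (∈-map⁺; ∈-map⁻; ∈-++⁺ˡ; ∈-++⁺ʳ; ∈-++⁻)
open import Data.Fin.Subset using (Subset; _∪_; inside; outside)
open import Data.Fin.Subset.Properties using (∪-identityʳ; ∪-idem)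
open import Function using (_∘_)
open import Relation.Nullary using (¬_; Dec; yes; no; _×-dec_; ¬?)
open import Relation.Binary.PropositionalEquality

∑ : {A : Set} → (A → ℤ) → List A → ℤ
∑ g = foldr (λ a s → g a + s) 0ℤ

module _ {A : Set} where

  ∑-++ : (g : A → ℤ) (xs ys : List A) → ∑ g (xs ++ ys) ≡ ∑ g xs + ∑ g ys
  ∑-++ g []       ys = sym (ℤ.+-identityˡ _)
  ∑-++ g (x ∷ xs) ys = trans (cong (λ s → g x + s) (∑-++ g xs ys)) (sym (ℤ.+-assoc (g x) _ _))

  ∑-map : {B : Set} (g : A → ℤ) (h : B → A) (xs : List B) → ∑ g (map h xs) ≡ ∑ (g ∘ h) xs
  ∑-map g h []       = refl
  ∑-map g h (x ∷ xs) = cong (λ s → g (h x) + s) (∑-map g h xs)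

  ∑-cong : {g h : A → ℤ} → (∀ a → g a ≡ h a) → (xs : List A) → ∑ g xs ≡ ∑ h xs
  ∑-cong g≗h []       = refl
  ∑-cong g≗h (x ∷ xs) = cong₂ _+_ (g≗h x) (∑-cong g≗h xs)

  ∑-+ : (g h : A → ℤ) (xs : List A) → ∑ (λ a → g a + h a) xs ≡ ∑ g xs + ∑ h xs
  ∑-+ g h []       = refl
  ∑-+ g h (x ∷ xs) =
    trans (cong (λ s → g x + h x + s) (∑-+ g h xs)) (interchange (g x) (h x) (∑ g xs) (∑ h xs))
    where
    interchange : ∀ a b c d → a + b + (c + d) ≡ a + c + (b + d)
    interchange = solve-∀

  ∑-*ˡ : (t : ℤ) (g : A → ℤ) (xs : List A) → ∑ (λ a → t * g a) xs ≡ t * ∑ g xs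
  ∑-*ˡ t g []       = sym (ℤ.*-zeroʳ t)
  ∑-*ˡ t g (x ∷ xs) = trans (cong (λ s → t * g x + s) (∑-*ˡ t g xs)) (sym (ℤ.*-distribˡ-+ t (g x) _))

slice : ∀ {n} → Bool → (Subset (suc n) → ℤ) → Subset n → ℤ
slice b c S = c (b ∷ S)

expansion-[] : (c : Subset zero → ℤ) → expansion c [] ≡ c []
expansion-[] c = trans (ℤ.+-identityʳ _) (ℤ.*-identityʳ _)

expansion-∷ : ∀ {n} (c : Subset (suc n) → ℤ) b x →
  expansion c (b ∷ x) ≡ expansion (slice outside c) x + toℤ b * expansion (slice inside c) x
expansion-∷ {n} c b x = begin
  expansion c (b ∷ x)
    ≡⟨ ∑-++ term (map (outside ∷_) Ss) (map (inside ∷_) Ss) ⟩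
  ∑ term (map (outside ∷_) Ss) + ∑ term (map (inside ∷_) Ss)
    ≡⟨ cong₂ _+_ (∑-map term (outside ∷_) Ss) (∑-map term (inside ∷_) Ss) ⟩
  E₀ + ∑ (λ S → c₁ S * (toℤ b * AND S x)) Ss
    ≡⟨ cong (E₀ +_) (∑-cong (λ S → swap (c₁ S) (toℤ b) (AND S x)) Ss) ⟩
  E₀ + ∑ (λ S → toℤ b * (c₁ S * AND S x)) Ss
    ≡⟨ cong (E₀ +_) (∑-*ˡ (toℤ b) (λ S → c₁ S * AND S x) Ss) ⟩
  E₀ + toℤ b * expansion c₁ x ∎
  where
  open ≡-Reasoning
  Ss = allSubsets n
  c₁ = slice inside c
  E₀ = expansion (slice outside c) x
  term : Subset (suc n) → ℤ
  term S = c S * AND S (b ∷ x)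
  swap : ∀ a t y → a * (t * y) ≡ t * (a * y)
  swap = solve-∀

expansion-outside : ∀ {n} (c : Subset (suc n) → ℤ) x →
  expansion c (false ∷ x) ≡ expansion (slice outside c) x
expansion-outside c x = trans (expansion-∷ c false x) (ℤ.+-identityʳ _)

expansion-inside : ∀ {n} (c : Subset (suc n) → ℤ) x →
  expansion c (true ∷ x) ≡ expansion (slice outside c) x + expansion (slice inside c) x
expansion-inside c x = trans (expansion-∷ c true x) (cong (expansion (slice outside c) x +_) (ℤ.*-identityˡ _))

expansion-cong : ∀ {n} {c d : Subset n → ℤ} → (∀ S → c S ≡ d S) → ∀ x → expansion c x ≡ expansion d x
expansion-cong {n} c≗d x = ∑-cong (λ S → cong (_* AND S x) (c≗d S)) (allSubsets n)

expansion-+ : ∀ {n} (c d : Subset n → ℤ) x →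
  expansion (λ S → c S + d S) x ≡ expansion c x + expansion d x
expansion-+ {n} c d x =
  trans (∑-cong (λ S → ℤ.*-distribʳ-+ (AND S x) (c S) (d S)) (allSubsets n))
        (∑-+ (λ S → c S * AND S x) (λ S → d S * AND S x) (allSubsets n))

ExpansionsAgree : ∀ {n} → (Subset n → ℤ) → (Subset n → ℤ) → Set
ExpansionsAgree c d = ∀ x → expansion c x ≡ expansion d x

module _ {n} (c d : Subset (suc n) → ℤ) (c≈d : ExpansionsAgree c d) where

  slice-outside-agree : ExpansionsAgree (slice outside c) (slice outside d)
  slice-outside-agree x = begin
    expansion (slice outside c) x ≡⟨ sym (expansion-outside c x) ⟩
    expansion c (false ∷ x)       ≡⟨ c≈d (false ∷ x) ⟩
    expansion d (false ∷ x)       ≡⟨ expansion-outside d x ⟩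
    expansion (slice outside d) x ∎
    where open ≡-Reasoning

  slice-inside-agree : ExpansionsAgree (slice inside c) (slice inside d)
  slice-inside-agree x = ∙-cancelˡ (expansion (slice outside c) x) _ _ (begin
    expansion (slice outside c) x + expansion (slice inside c) x ≡⟨ sym (expansion-inside c x) ⟩
    expansion c (true ∷ x)                                       ≡⟨ c≈d (true ∷ x) ⟩
    expansion d (true ∷ x)                                       ≡⟨ expansion-inside d x ⟩
    expansion (slice outside d) x + expansion (slice inside d) x ≡⟨ cong (_+ _) (sym (slice-outside-agree x)) ⟩
    expansion (slice outside c) x + expansion (slice inside d) x ∎)
    where open ≡-Reasoning

expansion-injective : ∀ n (c d : Subset n → ℤ) → ExpansionsAgree c d → ∀ W → c W ≡ d W
expansion-injective zero c d c≈d [] = trans (sym (expansion-[] c)) (trans (c≈d []) (expansion-[] d))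
expansion-injective (suc n) c d c≈d (outside ∷ W) =
  expansion-injective n (slice outside c) (slice outside d) (slice-outside-agree c d c≈d) W
expansion-injective (suc n) c d c≈d (inside ∷ W) =
  expansion-injective n (slice inside c) (slice inside d) (slice-inside-agree c d c≈d) W

extend : ∀ {n} → Bool → Bool → Subset n × Subset n → Subset (suc n) × Subset (suc n)
extend a b (A , B) = a ∷ A , b ∷ B

coverings : ∀ {n} → Subset n → List (Subset n × Subset n)
coverings []            = ([] , []) ∷ []
coverings (outside ∷ W) = map (extend outside outside) (coverings W)
coverings (inside ∷ W)  =
  map (extend outside inside) (coverings W) ++
  map (extend inside outside) (coverings W) ++
  map (extend inside inside) (coverings W)

_⊗_ : ∀ {n} → (Subset n → ℤ) → (Subset n → ℤ) → Subset n × Subset n → ℤ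
(c ⊗ d) (A , B) = c A * d B

_⋆_ : ∀ {n} → (Subset n → ℤ) → (Subset n → ℤ) → Subset n → ℤ
(c ⋆ d) W = ∑ (c ⊗ d) (coverings W)

⋆-outside : ∀ {n} (c d : Subset (suc n) → ℤ) W →
  (c ⋆ d) (outside ∷ W) ≡ (slice outside c ⋆ slice outside d) W
⋆-outside c d W = ∑-map (c ⊗ d) (extend outside outside) (coverings W)

⋆-inside : ∀ {n} (c d : Subset (suc n) → ℤ) W →
  (c ⋆ d) (inside ∷ W) ≡
  (slice outside c ⋆ slice inside d) W + ((slice inside c ⋆ slice outside d) W + (slice inside c ⋆ slice inside d) W)
⋆-inside c d W = begin
  (c ⋆ d) (inside ∷ W)
    ≡⟨ ∑-++ (c ⊗ d) (part outside inside) _ ⟩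
  ∑ (c ⊗ d) (part outside inside) + ∑ (c ⊗ d) (part inside outside ++ part inside inside)
    ≡⟨ cong (∑ (c ⊗ d) (part outside inside) +_) (∑-++ (c ⊗ d) (part inside outside) _) ⟩
  ∑ (c ⊗ d) (part outside inside) + (∑ (c ⊗ d) (part inside outside) + ∑ (c ⊗ d) (part inside inside))
    ≡⟨ cong₂ _+_ (∑-map (c ⊗ d) _ (coverings W))
                 (cong₂ _+_ (∑-map (c ⊗ d) _ (coverings W)) (∑-map (c ⊗ d) _ (coverings W))) ⟩
  (slice outside c ⋆ slice inside d) W + ((slice inside c ⋆ slice outside d) W + (slice inside c ⋆ slice inside d) W) ∎
  where
  open ≡-Reasoning
  part : Bool → Bool → List _
  part a b = map (extend a b) (coverings W)

toℤ-idem : ∀ b → toℤ b * toℤ b ≡ toℤ b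
toℤ-idem true  = refl
toℤ-idem false = refl

expand-idempotent-scalar : ∀ t a b c d → t * t ≡ t →
  (a + t * b) * (c + t * d) ≡ a * c + t * (a * d + (b * c + b * d))
expand-idempotent-scalar t a b c d t²≡t = begin
  (a + t * b) * (c + t * d)                           ≡⟨ expand t a b c d ⟩
  a * c + t * (a * d + b * c) + (t * t) * (b * d)     ≡⟨ cong (λ s → a * c + t * (a * d + b * c) + s * (b * d)) t²≡t ⟩
  a * c + t * (a * d + b * c) + t * (b * d)           ≡⟨ collect t a b c d ⟩
  a * c + t * (a * d + (b * c + b * d))               ∎
  where
  open ≡-Reasoning
  expand : ∀ t a b c d → (a + t * b) * (c + t * d) ≡ a * c + t * (a * d + b * c) + (t * t) * (b * d)
  expand = solve-∀
  collect : ∀ t a b c d → a * c + t * (a * d + b * c) + t * (b * d) ≡ a * c + t * (a * d + (b * c + b * d))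
  collect = solve-∀

expansion-* : ∀ n (c d : Subset n → ℤ) x → expansion c x * expansion d x ≡ expansion (c ⋆ d) x
expansion-* zero c d [] =
  trans (cong₂ _*_ (expansion-[] c) (expansion-[] d)) (sym (trans (expansion-[] (c ⋆ d)) (ℤ.+-identityʳ _)))
expansion-* (suc n) c d (b ∷ x) = begin
  expansion c (b ∷ x) * expansion d (b ∷ x)
    ≡⟨ cong₂ _*_ (expansion-∷ c b x) (expansion-∷ d b x) ⟩
  (E c₀ + t * E c₁) * (E d₀ + t * E d₁)
    ≡⟨ expand-idempotent-scalar t (E c₀) (E c₁) (E d₀) (E d₁) (toℤ-idem b) ⟩
  E c₀ * E d₀ + t * (E c₀ * E d₁ + (E c₁ * E d₀ + E c₁ * E d₁))
    ≡⟨ cong₂ (λ u v → u + t * v) (expansion-* n c₀ d₀ x)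
         (cong₂ _+_ (expansion-* n c₀ d₁ x) (cong₂ _+_ (expansion-* n c₁ d₀ x) (expansion-* n c₁ d₁ x))) ⟩
  E (c₀ ⋆ d₀) + t * (E (c₀ ⋆ d₁) + (E (c₁ ⋆ d₀) + E (c₁ ⋆ d₁)))
    ≡⟨ cong (λ v → E (c₀ ⋆ d₀) + t * v) (sym (trans (expansion-+ (c₀ ⋆ d₁) _ x)
         (cong (E (c₀ ⋆ d₁) +_) (expansion-+ (c₁ ⋆ d₀) (c₁ ⋆ d₁) x)))) ⟩
  E (c₀ ⋆ d₀) + t * E (λ W → (c₀ ⋆ d₁) W + ((c₁ ⋆ d₀) W + (c₁ ⋆ d₁) W))
    ≡⟨ cong₂ (λ u v → u + t * v) (expansion-cong (λ W → sym (⋆-outside c d W)) x)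
                                 (expansion-cong (λ W → sym (⋆-inside c d W)) x) ⟩
  E (slice outside (c ⋆ d)) + t * E (slice inside (c ⋆ d))
    ≡⟨ sym (expansion-∷ (c ⋆ d) b x) ⟩
  expansion (c ⋆ d) (b ∷ x) ∎
  where
  open ≡-Reasoning
  t = toℤ b
  E : (Subset n → ℤ) → ℤ
  E e = expansion e x
  c₀ = slice outside c
  c₁ = slice inside c
  d₀ = slice outside d
  d₁ = slice inside d

mobius-⋆-idem : ∀ {n} {f : Vec Bool n → Bool} {c : Subset n → ℤ} →
  IsMobiusExpansion f c → ∀ W → (c ⋆ c) W ≡ c W
mobius-⋆-idem {n} {f} {c} f≈c = expansion-injective n (c ⋆ c) c λ x → begin
  expansion (c ⋆ c) x               ≡⟨ sym (expansion-* n c c x) ⟩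
  expansion c x * expansion c x     ≡⟨ cong₂ _*_ (sym (f≈c x)) (sym (f≈c x)) ⟩
  toℤ (f x) * toℤ (f x)             ≡⟨ toℤ-idem (f x) ⟩
  toℤ (f x)                         ≡⟨ f≈c x ⟩
  expansion c x                     ∎
  where open ≡-Reasoning

∈-coverings⁺ : ∀ {n} (S T : Subset n) → (S , T) ∈ coverings (S ∪ T)
∈-coverings⁺ []            []            = here refl
∈-coverings⁺ (outside ∷ S) (outside ∷ T) = ∈-map⁺ (extend outside outside) (∈-coverings⁺ S T)
∈-coverings⁺ (outside ∷ S) (inside ∷ T)  = ∈-++⁺ˡ (∈-map⁺ (extend outside inside) (∈-coverings⁺ S T))
∈-coverings⁺ (inside ∷ S)  (outside ∷ T) =
  ∈-++⁺ʳ (map (extend outside inside) (coverings (S ∪ T)))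
    (∈-++⁺ˡ (∈-map⁺ (extend inside outside) (∈-coverings⁺ S T)))
∈-coverings⁺ (inside ∷ S)  (inside ∷ T)  =
  ∈-++⁺ʳ (map (extend outside inside) (coverings (S ∪ T)))
    (∈-++⁺ʳ (map (extend inside outside) (coverings (S ∪ T)))
      (∈-map⁺ (extend inside inside) (∈-coverings⁺ S T)))

∈-map-extend⁻ : ∀ {n} {C : List (Subset n × Subset n)} {W a b p} →
  (∀ {q} → q ∈ C → uncurry _∪_ q ≡ W) → p ∈ map (extend a b) C → uncurry _∪_ p ≡ (a ∨ b) ∷ W
∈-map-extend⁻ {a = a} {b} covers p∈ with ∈-map⁻ (extend a b) p∈
... | q , q∈ , refl = cong ((a ∨ b) ∷_) (covers q∈)

∈-coverings⁻ : ∀ {n} {W : Subset n} {p} → p ∈ coverings W → uncurry _∪_ p ≡ W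
∈-coverings⁻ {W = []}          (here refl) = refl
∈-coverings⁻ {W = outside ∷ W} p∈ = ∈-map-extend⁻ (∈-coverings⁻ {W = W}) p∈
∈-coverings⁻ {W = inside ∷ W}  p∈ with ∈-++⁻ (map (extend outside inside) (coverings W)) p∈
... | inj₁ p∈₀₁ = ∈-map-extend⁻ (∈-coverings⁻ {W = W}) p∈₀₁
... | inj₂ p∈′ with ∈-++⁻ (map (extend inside outside) (coverings W)) p∈′
...   | inj₁ p∈₁₀ = ∈-map-extend⁻ (∈-coverings⁻ {W = W}) p∈₁₀
...   | inj₂ p∈₁₁ = ∈-map-extend⁻ (∈-coverings⁻ {W = W}) p∈₁₁

module _ {A : Set} (g : A → ℤ) {v : ℤ} where

  ∑-multiple : {xs : List A} → All (λ a → g a ≡ v ⊎ g a ≡ 0ℤ) xs → ∃ λ m → ∑ g xs ≡ Int.+ m * v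
  ∑-multiple []                 = 0 , sym (ℤ.*-zeroˡ v)
  ∑-multiple (inj₁ ga≡v ∷ rest) with ∑-multiple rest
  ... | m , ∑≡mv = suc m , trans (cong₂ _+_ ga≡v ∑≡mv) (sym (ℤ.suc-* (Int.+ m) v))
  ∑-multiple (inj₂ ga≡0 ∷ rest) with ∑-multiple rest
  ... | m , ∑≡mv = m , trans (cong₂ _+_ ga≡0 ∑≡mv) (ℤ.+-identityˡ _)

  ∑-positive-multiple : {xs : List A} → All (λ a → g a ≡ v ⊎ g a ≡ 0ℤ) xs → Any (λ a → g a ≡ v) xs →
    ∃ λ m → ∑ g xs ≡ Int.+ suc m * v
  ∑-positive-multiple (_ ∷ rest) (here ga≡v) with ∑-multiple rest
  ... | m , ∑≡mv = m , trans (cong₂ _+_ ga≡v ∑≡mv) (sym (ℤ.suc-* (Int.+ m) v))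
  ∑-positive-multiple (inj₁ ga≡v ∷ rest) (there any) with ∑-positive-multiple rest any
  ... | m , ∑≡mv = suc m , trans (cong₂ _+_ ga≡v ∑≡mv) (sym (ℤ.suc-* (Int.+ suc m) v))
  ∑-positive-multiple (inj₂ ga≡0 ∷ rest) (there any) with ∑-positive-multiple rest any
  ... | m , ∑≡mv = m , trans (cong₂ _+_ ga≡0 ∑≡mv) (ℤ.+-identityˡ _)

  ∑-≢0 : v ≢ 0ℤ → {xs : List A} → All (λ a → g a ≡ v ⊎ g a ≡ 0ℤ) xs → Any (λ a → g a ≡ v) xs → ∑ g xs ≢ 0ℤ
  ∑-≢0 v≢0 all any ∑≡0 with ∑-positive-multiple all any
  ... | m , ∑≡mv with ℤ.i*j≡0⇒i≡0∨j≡0 (Int.+ suc m) (trans (sym ∑≡mv) ∑≡0)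
  ...   | inj₂ v≡0 = v≢0 v≡0

_≟ₚ_ : ∀ {n} (p q : Subset n × Subset n) → Dec (p ≡ q)
_≟ₚ_ = Product.≡-dec (Vec.≡-dec Bool._≟_) (Vec.≡-dec Bool._≟_)

*-≢0 : ∀ {a b} → a ≢ 0ℤ → b ≢ 0ℤ → a * b ≢ 0ℤ
*-≢0 {a} a≢0 b≢0 ab≡0 with ℤ.i*j≡0⇒i≡0∨j≡0 a ab≡0
... | inj₁ a≡0 = a≢0 a≡0
... | inj₂ b≡0 = b≢0 b≡0

*-≢0ˡ : ∀ {a} b → a * b ≢ 0ℤ → a ≢ 0ℤ
*-≢0ˡ b ab≢0 refl = ab≢0 refl

*-≢0ʳ : ∀ a {b} → a * b ≢ 0ℤ → b ≢ 0ℤ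
*-≢0ʳ a ab≢0 refl = ab≢0 (ℤ.*-zeroʳ a)

module _ {n} (c : Subset n → ℤ) (S T : Subset n) where

  Offdiagonal : Subset n × Subset n → Set
  Offdiagonal p = p ≢ (S , T) × p ≢ (T , S) × (c ⊗ c) p ≢ 0ℤ

  offdiagonal? : ∀ p → Dec (Offdiagonal p)
  offdiagonal? p = ¬? (p ≟ₚ (S , T)) ×-dec ¬? (p ≟ₚ (T , S)) ×-dec ¬? ((c ⊗ c) p ≟ 0ℤ)

  ¬offdiagonal⇒diagonal⊎zero : ∀ {p} → ¬ Offdiagonal p → (c ⊗ c) p ≡ c S * c T ⊎ (c ⊗ c) p ≡ 0ℤ
  ¬offdiagonal⇒diagonal⊎zero {p} ¬off with p ≟ₚ (S , T) | p ≟ₚ (T , S) | (c ⊗ c) p ≟ 0ℤ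
  ... | yes refl | _        | _        = inj₁ refl
  ... | no _     | yes refl | _        = inj₁ (ℤ.*-comm (c T) (c S))
  ... | no _     | no _     | yes p≡0  = inj₂ p≡0
  ... | no p≢ST  | no p≢TS  | no p≢0   = ⊥-elim (¬off (p≢ST , p≢TS , p≢0))

⋆-idem-offdiagonal-cover : ∀ {n} {c : Subset n → ℤ} → (∀ W → (c ⋆ c) W ≡ c W) →
  ∀ {S T} → c S ≢ 0ℤ → c T ≢ 0ℤ → c (S ∪ T) ≡ 0ℤ →
  ∃ λ p → p ∈ coverings (S ∪ T) × Offdiagonal c S T p
⋆-idem-offdiagonal-cover {c = c} c⋆c≡c {S} {T} cS≢0 cT≢0 cS∪T≡0
  with any? (offdiagonal? c S T) (coverings (S ∪ T))
... | yes found = find found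
... | no none   = ⊥-elim (∑-≢0 (c ⊗ c) (*-≢0 cS≢0 cT≢0)
                    (All.map (¬offdiagonal⇒diagonal⊎zero c S T) (¬Any⇒All¬ _ none))
                    (lose (∈-coverings⁺ S T) refl)
                    (trans (c⋆c≡c (S ∪ T)) cS∪T≡0))

Enumerates : ∀ {n} → List (Subset n) → Subset n → Subset n → Set
Enumerates p S T = ∀ U → (U ∈ p → (U ≡ S ⊎ U ≡ T)) × ((U ≡ S ⊎ U ≡ T) → U ∈ p)

singleton-¬enumerates : ∀ {n} {S T : Subset n} → S ≢ T → ∀ U → ¬ Enumerates (U ∷ []) S T
singleton-¬enumerates S≢T U enum with proj₂ (enum _) (inj₁ refl) | proj₂ (enum _) (inj₂ refl)
... | here refl | here refl = S≢T refl

pair-¬enumerates : ∀ {n} {S T A B : Subset n} →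
  A ≢ B → (A , B) ≢ (S , T) → (A , B) ≢ (T , S) → ¬ Enumerates (A ∷ B ∷ []) S T
pair-¬enumerates A≢B AB≢ST AB≢TS enum
  with proj₁ (enum _) (here refl) | proj₁ (enum _) (there (here refl))
... | inj₁ refl | inj₁ refl = A≢B refl
... | inj₁ refl | inj₂ refl = AB≢ST refl
... | inj₂ refl | inj₁ refl = AB≢TS refl
... | inj₂ refl | inj₂ refl = A≢B refl

claim9 : (n : ℕ) (f : Vec Bool n → Bool) (c : Subset n → ℤ) →
    IsMobiusExpansion f c →
    (S T : Subset n) → InSupport c S → InSupport c T → S ≢ T →
    Σ (List (Subset n)) λ p →
      Unique p × All (InSupport c) p ×
      ¬ (∀ U → (U ∈ p → (U ≡ S ⊎ U ≡ T)) × ((U ≡ S ⊎ U ≡ T) → U ∈ p)) ×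
      (¬ InSupport c (S ∪ T) → length p ≡ 2) ×
      (InSupport c (S ∪ T) → length p ≡ 1) ×
      ⋃ p ≡ S ∪ T
claim9 n f c f≈c S T cS≢0 cT≢0 S≢T with c (S ∪ T) ≟ 0ℤ
... | no cS∪T≢0 =
  (S ∪ T) ∷ [] , [] ∷ [] , cS∪T≢0 ∷ [] , singleton-¬enumerates S≢T (S ∪ T) ,
  (λ ∉supp → ⊥-elim (∉supp cS∪T≢0)) , (λ _ → refl) , ∪-identityʳ (S ∪ T)
... | yes cS∪T≡0 with ⋆-idem-offdiagonal-cover (mobius-⋆-idem f≈c) cS≢0 cT≢0 cS∪T≡0
...   | (A , B) , AB∈ , AB≢ST , AB≢TS , cAcB≢0 =
  A ∷ B ∷ [] , (A≢B ∷ []) ∷ [] ∷ [] , cA≢0 ∷ cB≢0 ∷ [] , pair-¬enumerates A≢B AB≢ST AB≢TS ,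
  (λ _ → refl) , (λ ∈supp → ⊥-elim (∈supp cS∪T≡0)) , trans (cong (A ∪_) (∪-identityʳ B)) (∈-coverings⁻ AB∈)
  where
  cA≢0 : c A ≢ 0ℤ
  cA≢0 = *-≢0ˡ (c B) cAcB≢0
  cB≢0 : c B ≢ 0ℤ
  cB≢0 = *-≢0ʳ (c A) cAcB≢0
  A≢B : A ≢ B
  A≢B refl = cA≢0 (trans (cong c (trans (sym (∪-idem A)) (∈-coverings⁻ AB∈))) cS∪T≡0)
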